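{- Let $D=(E,\mathcal F)$ be a delta-matroid and $e\in E$. Then $$\rho(D)=\begin{cases}\rho(D/e)+1&\text{if $e$ is not a ribbon loop},\\ \rho(D/e)&\text{if $e$ is an orientable ribbon loop},\\ \rho(D/e)+\tfrac12&\text{if $e$ is a non-orientable ribbon loop}.\end{cases}$$
   Context: A delta-matroid $D=(E,\mathcal F)$: finite $E$ and nonempty family $\mathcal F$ of subsets with: for $X,Y\in\mathcal F$ and $u\in X\triangle Y$ there is $v\in X\triangle Y$ with $X\triangle\{u,v\}\in\mathcal F$. $e$ is a coloop if in every feasible set, a loop if in none. If $e$ is not a loop, $D/e=(E\setminus e,\{F\setminus e:e\in F\in\mathcal F\})$; if $e$ is a loop, $D/e=(E\setminus e,\mathcal F)$. Twist: $D*A=(E,\{A\triangle X:X\in\mathcal F\})$. $r_{\max}(D)$ and $r_{\min}(D)$ are the maximum and minimum cardinalities of feasible sets, and $\rho(D)=\frac12(r_{\max}(D)+r_{\min}(D))$. $\mathcal F_{\min}$ is the set of minimum-cardinality feasible sets and $D_{\min}=(E,\mathcal F_{\min})$; $e$ is a ribbon loop if it lies in no set of $\mathcal F_{\min}$; a ribbon loop is orientable if $e$ lies in some minimum-cardinality feasible set of $D*\{e\}$, and non-orientable otherwise. -}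

module Defs where

open import Data.Nat using (ℕ; zero; suc; _+_; _⊔_; _⊓_)
open import Data.Bool using (Bool; true; false; T; _xor_; _∧_; if_then_else_)
open import Data.Fin using (Fin)
open import Data.Fin.Subset using (Subset; ∣_∣; ⁅_⁆; _∪_; _∈_; _∉_)
open import Data.Vec using (Vec; []; _∷_; zipWith; insertAt; lookup)
open import Data.List using (List; []; _∷_; map; _++_; filter; foldr)
open import Data.Bool.ListAction using (any)
open import Data.Product using (Σ; _×_; ∃; _,_)
open import Relation.Binary.PropositionalEquality using (_≡_)
open import Relation.Nullary using (¬_)
open import Relation.Unary using (Pred)
open import Data.Bool.Properties using (T?)

-- A set system on the ground set E = Fin n, given by its (decidable)
-- membership test: X is feasible iff F X = true.
Family : ℕ → Set
Family n = Subset n → Bool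

Feasible : ∀ {n} → Family n → Subset n → Set
Feasible F X = T (F X)

_△_ : ∀ {n} → Subset n → Subset n → Subset n
X △ Y = zipWith _xor_ X Y

record IsDeltaMatroid {n : ℕ} (F : Family n) : Set where
  field
    nonempty : ∃ λ X → Feasible F X
    exchange : ∀ X Y → Feasible F X → Feasible F Y →
               ∀ u → u ∈ (X △ Y) →
               ∃ λ v → v ∈ (X △ Y) × Feasible F (X △ (⁅ u ⁆ ∪ ⁅ v ⁆))

allSubsets : (n : ℕ) → List (Subset n)
allSubsets zero = [] ∷ []
allSubsets (suc n) = map (true ∷_) (allSubsets n) ++ map (false ∷_) (allSubsets n)

feasibleSets : ∀ {n} → Family n → List (Subset n)
feasibleSets {n} F = filter (λ X → T? (F X)) (allSubsets n)

rmax : ∀ {n} → Family n → ℕ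
rmax F = foldr (λ X r → ∣ X ∣ ⊔ r) 0 (feasibleSets F)

-- minimum cardinality of a feasible set (n is an upper bound for every
-- cardinality, so this is the true minimum whenever F is nonempty)
rmin : ∀ {n} → Family n → ℕ
rmin {n} F = foldr (λ X r → ∣ X ∣ ⊓ r) n (feasibleSets F)

-- twice rho(D) = r_max(D) + r_min(D)   (avoids half-integers)
twoRho : ∀ {n} → Family n → ℕ
twoRho F = rmax F + rmin F

twist : ∀ {n} → Family n → Subset n → Family n
twist F A X = F (A △ X)

isLoopᵇ : ∀ {n} → Family n → Fin n → Bool
isLoopᵇ {n} F e = if any (λ X → F X ∧ lookup X e) (allSubsets n) then false else true

-- contraction D / e on the ground set E \ e ≅ Fin n.
-- A subset Y of E \ e corresponds to insertAt Y e b in Fin (suc n).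
contract : ∀ {n} → Family (suc n) → Fin (suc n) → Family n
contract F e Y =
  if isLoopᵇ F e then F (insertAt Y e false)   -- loop: D/e = (E\e, F)
                 else F (insertAt Y e true)    -- else: {F \ e : e ∈ F ∈ 𝓕}

RibbonLoop : ∀ {n} → Family n → Fin n → Set
RibbonLoop F e = ∀ X → Feasible F X → ∣ X ∣ ≡ rmin F → e ∉ X

OrientableAt : ∀ {n} → Family n → Fin n → Set
OrientableAt F e =
  ∃ λ X → Feasible (twist F ⁅ e ⁆) X × ∣ X ∣ ≡ rmin (twist F ⁅ e ⁆) × e ∈ X

-- Let a = r_min(D) and let m be the least size of a feasible set containing e.
-- If e is not a loop, the feasible sets of D/e are the X \ e with e ∈ X, so
-- r_min(D/e) = m - 1, and r_max(D/e) = r_max(D) - 1 because one exchange with a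
-- maximum feasible set produces a maximum feasible set containing e.  A similar
-- exchange with a minimum feasible set gives a ≤ m ≤ a + 2.  Now e is a ribbon
-- loop iff m > a, and then r_min(D * {e}) = min (a + 1) (m - 1), attained by a
-- set containing e iff m = a + 2; so m = a, a + 1, a + 2 are the three cases of
-- the formula.  If e is a loop, D/e has the same feasible sets as D and e is an
-- orientable ribbon loop.
module Submission where

open import Data.Bool using (Bool; true; false; T; not; _xor_; _∧_)
open import Data.Bool.ListAction using (any)
open import Data.Bool.Properties
  using (T?; T-≡; T-∧; ¬-not; xor-comm; xor-assoc; xor-same; xor-identityˡ; xor-identityʳ)
open import Data.Fin using (Fin; zero; suc; _≟_)
open import Data.Fin.Subset using (Subset; ∣_∣; ⁅_⁆; _∪_; _∈_; _∉_; ⊥)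
open import Data.Fin.Subset.Properties using (_∈?_; ∣p∣≤n; ∪-idem; ∪-identityˡ; ∪-identityʳ)
open import Data.List using (List; []; _∷_; map; foldr)
open import Data.List.Membership.Propositional using (lose) renaming (_∈_ to _∈ₗ_)
open import Data.List.Membership.Propositional.Properties
  using (∈-filter⁺; ∈-filter⁻; ∈-map⁺; ∈-++⁺ˡ; ∈-++⁺ʳ)
open import Data.List.Relation.Unary.Any using (here; there; satisfied)
open import Data.List.Relation.Unary.Any.Properties using (any⁺; any⁻)
open import Data.Nat using (ℕ; zero; suc; _+_; _⊔_; _⊓_; _≤_; s≤s; s≤s⁻¹)
open import Data.Nat.Properties
  using ( ≤-refl; ≤-reflexive; ≤-trans; ≤-antisym; <-irrefl; 1+n≰n; n≤1+n; m≤n+m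
        ; suc-injective; +-suc; +-comm; m≤m⊔n; m≤n⊔m; ⊔-identityʳ; ⊔-sel
        ; m⊓n≤m; m⊓n≤n; m≤n⇒m⊓n≡m; ⊓-sel )
open import Data.Product using (_×_; ∃; _,_; proj₁; proj₂)
open import Data.Sum as Sum using (_⊎_; inj₁; inj₂; [_,_]′)
open import Data.Vec using ([]; _∷_; insertAt; removeAt; lookup; here; there)
open import Data.Vec.Properties
  using ( []=⇒lookup; lookup⇒[]=; insertAt-removeAt; insertAt-lookup
        ; zipWith-comm; zipWith-assoc; zipWith-identityˡ; zipWith-identityʳ )
open import Function using (_∘_; Equivalence)
open import Relation.Binary.PropositionalEquality
  using (_≡_; refl; sym; trans; cong; cong₂; subst; subst₂; module ≡-Reasoning)
open import Relation.Nullary using (¬_; contradiction; yes; no)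

open import Defs

private variable
  n : ℕ
  u v : Fin n
  X Y : Subset n

-- Extremal cardinalities

allSubsets-complete : (X : Subset n) → X ∈ₗ allSubsets n
allSubsets-complete [] = here refl
allSubsets-complete {suc n} (true ∷ X) =
  ∈-++⁺ˡ (∈-map⁺ (true ∷_) (allSubsets-complete X))
allSubsets-complete {suc n} (false ∷ X) =
  ∈-++⁺ʳ (map (true ∷_) (allSubsets n)) (∈-map⁺ (false ∷_) (allSubsets-complete X))

∈-feasibleSets⁺ : (F : Family n) {X : Subset n} → Feasible F X → X ∈ₗ feasibleSets F
∈-feasibleSets⁺ F {X} = ∈-filter⁺ (T? ∘ F) (allSubsets-complete X)

∈-feasibleSets⁻ : (F : Family n) {X : Subset n} → X ∈ₗ feasibleSets F → Feasible F X
∈-feasibleSets⁻ {n = n} F = proj₂ ∘ ∈-filter⁻ (T? ∘ F) {xs = allSubsets n}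

private
  maxSize minSize : List (Subset n) → ℕ
  maxSize = foldr (λ X r → ∣ X ∣ ⊔ r) 0
  minSize {n} = foldr (λ X r → ∣ X ∣ ⊓ r) n

  ∣X∣≤maxSize : ∀ Xs → X ∈ₗ Xs → ∣ X ∣ ≤ maxSize Xs
  ∣X∣≤maxSize (_ ∷ Xs) (here refl) = m≤m⊔n _ _
  ∣X∣≤maxSize (_ ∷ Xs) (there p)   = ≤-trans (∣X∣≤maxSize Xs p) (m≤n⊔m _ _)

  minSize≤∣X∣ : ∀ Xs → X ∈ₗ Xs → minSize Xs ≤ ∣ X ∣
  minSize≤∣X∣ (_ ∷ Xs) (here refl) = m⊓n≤m _ _
  minSize≤∣X∣ (_ ∷ Xs) (there p)   = ≤-trans (m⊓n≤n _ _) (minSize≤∣X∣ Xs p)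

  maxSize-attained : ∀ (X : Subset n) Xs → ∃ λ Y → Y ∈ₗ X ∷ Xs × ∣ Y ∣ ≡ maxSize (X ∷ Xs)
  maxSize-attained X []        = X , here refl , sym (⊔-identityʳ _)
  maxSize-attained X (X′ ∷ Xs) with maxSize-attained X′ Xs | ⊔-sel ∣ X ∣ (maxSize (X′ ∷ Xs))
  ... | _ , _     , _    | inj₁ eq = X , here refl , sym eq
  ... | Y , Y∈Xs , ∣Y∣≡ | inj₂ eq = Y , there Y∈Xs , trans ∣Y∣≡ (sym eq)

  minSize-attained : ∀ (X : Subset n) Xs → ∃ λ Y → Y ∈ₗ X ∷ Xs × ∣ Y ∣ ≡ minSize (X ∷ Xs)
  minSize-attained X []        = X , here refl , sym (m≤n⇒m⊓n≡m (∣p∣≤n X))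
  minSize-attained X (X′ ∷ Xs) with minSize-attained X′ Xs | ⊓-sel ∣ X ∣ (minSize (X′ ∷ Xs))
  ... | _ , _     , _    | inj₁ eq = X , here refl , sym eq
  ... | Y , Y∈Xs , ∣Y∣≡ | inj₂ eq = Y , there Y∈Xs , trans ∣Y∣≡ (sym eq)

module _ (F : Family n) where

  ∣X∣≤rmax : Feasible F X → ∣ X ∣ ≤ rmax F
  ∣X∣≤rmax = ∣X∣≤maxSize (feasibleSets F) ∘ ∈-feasibleSets⁺ F

  rmin≤∣X∣ : Feasible F X → rmin F ≤ ∣ X ∣
  rmin≤∣X∣ = minSize≤∣X∣ (feasibleSets F) ∘ ∈-feasibleSets⁺ F

  rmax-attained : Feasible F X → ∃ λ Y → Feasible F Y × ∣ Y ∣ ≡ rmax F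
  rmax-attained X∈F with feasibleSets F | ∈-feasibleSets⁺ F X∈F | ∈-feasibleSets⁻ F
  ... | Z ∷ Zs | _ | feasible with maxSize-attained Z Zs
  ...   | Y , Y∈ , ∣Y∣≡ = Y , feasible Y∈ , ∣Y∣≡

  rmin-attained : Feasible F X → ∃ λ Y → Feasible F Y × ∣ Y ∣ ≡ rmin F
  rmin-attained X∈F with feasibleSets F | ∈-feasibleSets⁺ F X∈F | ∈-feasibleSets⁻ F
  ... | Z ∷ Zs | _ | feasible with minSize-attained Z Zs
  ...   | Y , Y∈ , ∣Y∣≡ = Y , feasible Y∈ , ∣Y∣≡

  rmax≡bound : ∀ {k} → (∀ {Y} → Feasible F Y → ∣ Y ∣ ≤ k) → Feasible F X → ∣ X ∣ ≡ k → rmax F ≡ k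
  rmax≡bound bound X∈F refl with rmax-attained X∈F
  ... | Y , Y∈F , ∣Y∣≡ = ≤-antisym (subst (_≤ _) ∣Y∣≡ (bound Y∈F)) (∣X∣≤rmax X∈F)

  rmin≡bound : ∀ {k} → (∀ {Y} → Feasible F Y → k ≤ ∣ Y ∣) → Feasible F X → ∣ X ∣ ≡ k → rmin F ≡ k
  rmin≡bound bound X∈F refl with rmin-attained X∈F
  ... | Y , Y∈F , ∣Y∣≡ = ≤-antisym (rmin≤∣X∣ X∈F) (subst (_ ≤_) ∣Y∣≡ (bound Y∈F))

-- Symmetric differences and insertion

△-comm : (X Y : Subset n) → X △ Y ≡ Y △ X
△-comm = zipWith-comm xor-comm

△-assoc : (X Y Z : Subset n) → (X △ Y) △ Z ≡ X △ (Y △ Z)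
△-assoc = zipWith-assoc xor-assoc

△-identityˡ : (X : Subset n) → ⊥ △ X ≡ X
△-identityˡ = zipWith-identityˡ xor-identityˡ

△-identityʳ : (X : Subset n) → X △ ⊥ ≡ X
△-identityʳ = zipWith-identityʳ xor-identityʳ

△-cancelʳ : (X Y : Subset n) → (X △ Y) △ Y ≡ X
△-cancelʳ []      []      = refl
△-cancelʳ (x ∷ X) (y ∷ Y) = cong₂ _∷_ x⊕y⊕y≡x (△-cancelʳ X Y)
  where
  x⊕y⊕y≡x : (x xor y) xor y ≡ x
  x⊕y⊕y≡x = trans (xor-assoc x y y) (trans (cong (x xor_) (xor-same y)) (xor-identityʳ x))

⁅u⁆∪⁅v⁆≡⁅u⁆△⁅v⁆ : ¬ u ≡ v → ⁅ u ⁆ ∪ ⁅ v ⁆ ≡ ⁅ u ⁆ △ ⁅ v ⁆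
⁅u⁆∪⁅v⁆≡⁅u⁆△⁅v⁆ {u = zero}  {zero}  u≢v = contradiction refl u≢v
⁅u⁆∪⁅v⁆≡⁅u⁆△⁅v⁆ {u = zero}  {suc v} _   =
  cong (true ∷_) (trans (∪-identityˡ ⁅ v ⁆) (sym (△-identityˡ ⁅ v ⁆)))
⁅u⁆∪⁅v⁆≡⁅u⁆△⁅v⁆ {u = suc u} {zero}  _   =
  cong (true ∷_) (trans (∪-identityʳ ⁅ u ⁆) (sym (△-identityʳ ⁅ u ⁆)))
⁅u⁆∪⁅v⁆≡⁅u⁆△⁅v⁆ {u = suc u} {suc v} u≢v = cong (false ∷_) (⁅u⁆∪⁅v⁆≡⁅u⁆△⁅v⁆ (u≢v ∘ cong suc))

△-⁅u⁆∪⁅v⁆ : ¬ u ≡ v → (X : Subset n) → X △ (⁅ u ⁆ ∪ ⁅ v ⁆) ≡ (X △ ⁅ u ⁆) △ ⁅ v ⁆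
△-⁅u⁆∪⁅v⁆ {u = u} {v} u≢v X =
  trans (cong (X △_) (⁅u⁆∪⁅v⁆≡⁅u⁆△⁅v⁆ u≢v)) (sym (△-assoc X ⁅ u ⁆ ⁅ v ⁆))

∈-△ : u ∉ X → u ∈ Y → u ∈ X △ Y
∈-△ {X = false ∷ X} _   here      = here
∈-△ {X = true  ∷ X} u∉X here      = contradiction here u∉X
∈-△ {X = x     ∷ X} u∉X (there p) = there (∈-△ (u∉X ∘ there) p)

∈-△⁅⁆ : u ∉ X → u ∈ X △ ⁅ u ⁆
∈-△⁅⁆ {u = zero}  {false ∷ X} _   = here
∈-△⁅⁆ {u = zero}  {true  ∷ X} u∉X = contradiction here u∉X
∈-△⁅⁆ {u = suc u} {x     ∷ X} u∉X = there (∈-△⁅⁆ (u∉X ∘ there))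

∈-△⁅⁆-≢ : ¬ u ≡ v → u ∈ X → u ∈ X △ ⁅ v ⁆
∈-△⁅⁆-≢ {v = zero}  u≢v here               = contradiction refl u≢v
∈-△⁅⁆-≢ {v = suc v} _   here               = here
∈-△⁅⁆-≢ {v = zero}  _   (there {xs = X} p) = there (subst (_ ∈_) (sym (△-identityʳ X)) p)
∈-△⁅⁆-≢ {v = suc v} u≢v (there p)          = there (∈-△⁅⁆-≢ (u≢v ∘ cong suc) p)

∣△⁅⁆∣-∈ : u ∈ X → suc ∣ X △ ⁅ u ⁆ ∣ ≡ ∣ X ∣
∣△⁅⁆∣-∈ (here {xs = X})         = cong (suc ∘ ∣_∣) (△-identityʳ X)
∣△⁅⁆∣-∈ (there {y = true}  u∈X) = cong suc (∣△⁅⁆∣-∈ u∈X)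
∣△⁅⁆∣-∈ (there {y = false} u∈X) = ∣△⁅⁆∣-∈ u∈X

∣△⁅⁆∣-∉ : u ∉ X → ∣ X △ ⁅ u ⁆ ∣ ≡ suc ∣ X ∣
∣△⁅⁆∣-∉ {u = u} {X = X} u∉X =
  trans (sym (∣△⁅⁆∣-∈ (∈-△⁅⁆ u∉X))) (cong (suc ∘ ∣_∣) (△-cancelʳ X ⁅ u ⁆))

∣X∣≤1+∣X△⁅u⁆∣ : ∀ (X : Subset n) u → ∣ X ∣ ≤ suc ∣ X △ ⁅ u ⁆ ∣
∣X∣≤1+∣X△⁅u⁆∣ X u with u ∈? X
... | yes u∈X = ≤-reflexive (sym (∣△⁅⁆∣-∈ u∈X))
... | no  u∉X = subst (∣ X ∣ ≤_) (cong suc (sym (∣△⁅⁆∣-∉ u∉X))) (m≤n+m ∣ X ∣ 2)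

∣X△⁅u⁆∣≤1+∣X∣ : ∀ (X : Subset n) u → ∣ X △ ⁅ u ⁆ ∣ ≤ suc ∣ X ∣
∣X△⁅u⁆∣≤1+∣X∣ X u with u ∈? X
... | yes u∈X = subst (∣ X △ ⁅ u ⁆ ∣ ≤_) (cong suc (∣△⁅⁆∣-∈ u∈X)) (m≤n+m _ 2)
... | no  u∉X = ≤-reflexive (∣△⁅⁆∣-∉ u∉X)

∣insertAt-true∣ : ∀ (Y : Subset n) e → ∣ insertAt Y e true ∣ ≡ suc ∣ Y ∣
∣insertAt-true∣ Y           zero    = refl
∣insertAt-true∣ (true  ∷ Y) (suc e) = cong suc (∣insertAt-true∣ Y e)
∣insertAt-true∣ (false ∷ Y) (suc e) = ∣insertAt-true∣ Y e

∣insertAt-false∣ : ∀ (Y : Subset n) e → ∣ insertAt Y e false ∣ ≡ ∣ Y ∣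
∣insertAt-false∣ Y           zero    = refl
∣insertAt-false∣ (true  ∷ Y) (suc e) = cong suc (∣insertAt-false∣ Y e)
∣insertAt-false∣ (false ∷ Y) (suc e) = ∣insertAt-false∣ Y e

∉⇒lookup≡false : u ∉ X → lookup X u ≡ false
∉⇒lookup≡false {u = u} {X} u∉X = ¬-not (u∉X ∘ lookup⇒[]= u X)

∣removeAt∣-∈ : ∀ {e : Fin (suc n)} {X} → e ∈ X → suc ∣ removeAt X e ∣ ≡ ∣ X ∣
∣removeAt∣-∈ {e = e} {X} e∈X = begin
  suc ∣ removeAt X e ∣                        ≡⟨ ∣insertAt-true∣ (removeAt X e) e ⟨
  ∣ insertAt (removeAt X e) e true ∣          ≡⟨ cong (∣_∣ ∘ insertAt _ e) ([]=⇒lookup e∈X) ⟨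
  ∣ insertAt (removeAt X e) e (lookup X e) ∣  ≡⟨ cong ∣_∣ (insertAt-removeAt X e) ⟩
  ∣ X ∣                                       ∎
  where open ≡-Reasoning

∣removeAt∣-∉ : ∀ {e : Fin (suc n)} {X} → e ∉ X → ∣ removeAt X e ∣ ≡ ∣ X ∣
∣removeAt∣-∉ {e = e} {X} e∉X = begin
  ∣ removeAt X e ∣                            ≡⟨ ∣insertAt-false∣ (removeAt X e) e ⟨
  ∣ insertAt (removeAt X e) e false ∣         ≡⟨ cong (∣_∣ ∘ insertAt _ e) (∉⇒lookup≡false e∉X) ⟨
  ∣ insertAt (removeAt X e) e (lookup X e) ∣  ≡⟨ cong ∣_∣ (insertAt-removeAt X e) ⟩
  ∣ X ∣                                       ∎
  where open ≡-Reasoning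

-- Loops, twists and contractions of set systems

module _ (F : Family n) (e : Fin n) where

  private
    feasible∋e : Subset n → Bool
    feasible∋e X = F X ∧ lookup X e

  isLoop⇒∉ : isLoopᵇ F e ≡ true → Feasible F X → e ∉ X
  isLoop⇒∉ {X = X} loop X∈F e∈X with any feasible∋e (allSubsets n) in eq
  ... | true  = contradiction loop λ ()
  ... | false = subst T eq (any⁺ feasible∋e (lose (allSubsets-complete X) X∋e))
    where
    X∋e : T (feasible∋e X)
    X∋e = Equivalence.from T-∧ (X∈F , Equivalence.from T-≡ ([]=⇒lookup e∈X))

  ¬isLoop⇒∈ : isLoopᵇ F e ≡ false → ∃ λ X → Feasible F X × e ∈ X
  ¬isLoop⇒∈ nonloop with any feasible∋e (allSubsets n) in eq
  ... | false = contradiction nonloop λ ()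
  ... | true  with satisfied (any⁻ feasible∋e (allSubsets n) (Equivalence.from T-≡ eq))
  ...   | X , X∋e with Equivalence.to T-∧ X∋e
  ...     | X∈F , e∈X = X , X∈F , lookup⇒[]= e X (Equivalence.to T-≡ e∈X)

  twist-⁅⁆ : ∀ Z → twist F ⁅ e ⁆ Z ≡ F (Z △ ⁅ e ⁆)
  twist-⁅⁆ Z = cong F (△-comm ⁅ e ⁆ Z)

  twist-feasible⁺ : Feasible F X → Feasible (twist F ⁅ e ⁆) (X △ ⁅ e ⁆)
  twist-feasible⁺ {X = X} = subst T (sym (trans (twist-⁅⁆ _) (cong F (△-cancelʳ X ⁅ e ⁆))))

  twist-feasible⁻ : ∀ {Z} → Feasible (twist F ⁅ e ⁆) Z → Feasible F (Z △ ⁅ e ⁆)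
  twist-feasible⁻ {Z} = subst T (twist-⁅⁆ Z)

  twist-lowerBound : ∀ k → (∀ {X} → Feasible F X → e ∉ X → k ≤ suc ∣ X ∣)
                         → (∀ {X} → Feasible F X → e ∈ X → suc k ≤ ∣ X ∣)
                         → ∀ {Z} → Feasible (twist F ⁅ e ⁆) Z → k ≤ ∣ Z ∣
  twist-lowerBound k outside inside {Z} Z∈F* with e ∈? Z △ ⁅ e ⁆
  ... | yes e∈Z△e = s≤s⁻¹ (subst (suc k ≤_) ∣Z△e∣≡1+∣Z∣ (inside (twist-feasible⁻ Z∈F*) e∈Z△e))
    where
    ∣Z△e∣≡1+∣Z∣ : ∣ Z △ ⁅ e ⁆ ∣ ≡ suc ∣ Z ∣
    ∣Z△e∣≡1+∣Z∣ = trans (sym (∣△⁅⁆∣-∈ e∈Z△e)) (cong (suc ∘ ∣_∣) (△-cancelʳ Z ⁅ e ⁆))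
  ... | no  e∉Z△e = subst (k ≤_) 1+∣Z△e∣≡∣Z∣ (outside (twist-feasible⁻ Z∈F*) e∉Z△e)
    where
    1+∣Z△e∣≡∣Z∣ : suc ∣ Z △ ⁅ e ⁆ ∣ ≡ ∣ Z ∣
    1+∣Z△e∣≡∣Z∣ = trans (sym (∣△⁅⁆∣-∉ e∉Z△e)) (cong ∣_∣ (△-cancelʳ Z ⁅ e ⁆))

module _ (F : Family (suc n)) (e : Fin (suc n)) where

  contract-≡ : ∀ {l} → isLoopᵇ F e ≡ l → ∀ Y → contract F e Y ≡ F (insertAt Y e (not l))
  contract-≡ {true}  loop Y rewrite loop = refl
  contract-≡ {false} loop Y rewrite loop = refl

  contract-feasible⁻ : ∀ {l} → isLoopᵇ F e ≡ l →
                       Feasible (contract F e) Y → Feasible F (insertAt Y e (not l))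
  contract-feasible⁻ {Y = Y} loop = subst T (contract-≡ loop Y)

  contract-feasible⁺ : ∀ {l} → isLoopᵇ F e ≡ l →
                       Feasible F X → lookup X e ≡ not l → Feasible (contract F e) (removeAt X e)
  contract-feasible⁺ {X = X} loop X∈F X[e]≡ =
    subst T (sym (trans (contract-≡ loop (removeAt X e)) F[X])) X∈F
    where
    F[X] : F (insertAt (removeAt X e) e _) ≡ F X
    F[X] = cong F (trans (cong (insertAt _ e) (sym X[e]≡)) (insertAt-removeAt X e))

-- Exchange

module _ {F : Family n} (D : IsDeltaMatroid F) where

  open IsDeltaMatroid D using (exchange)

  feasible-∋-near : Feasible F X → u ∈ X → Feasible F Y →
                    ∃ λ W → Feasible F W × u ∈ W × ∣ Y ∣ ≤ ∣ W ∣ × ∣ W ∣ ≤ 2 + ∣ Y ∣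
  feasible-∋-near {X = X} {u} {Y} X∈F u∈X Y∈F with u ∈? Y
  ... | yes u∈Y = Y , Y∈F , u∈Y , ≤-refl , m≤n+m ∣ Y ∣ 2
  ... | no  u∉Y with exchange Y X Y∈F X∈F u (∈-△ u∉Y u∈X)
  ...   | v , _ , W∈F with u ≟ v
  ...     | yes refl = Y △ ⁅ u ⁆ , subst (Feasible F ∘ (Y △_)) (∪-idem ⁅ u ⁆) W∈F , ∈-△⁅⁆ u∉Y
                     , ≤-trans (n≤1+n _) (≤-reflexive (sym (∣△⁅⁆∣-∉ u∉Y)))
                     , ≤-trans (≤-reflexive (∣△⁅⁆∣-∉ u∉Y)) (n≤1+n _)
  ...     | no  u≢v = W , subst (Feasible F) (△-⁅u⁆∪⁅v⁆ u≢v Y) W∈F , ∈-△⁅⁆-≢ u≢v (∈-△⁅⁆ u∉Y)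
                    , s≤s⁻¹ (subst (_≤ suc ∣ W ∣) (∣△⁅⁆∣-∉ u∉Y) (∣X∣≤1+∣X△⁅u⁆∣ (Y △ ⁅ u ⁆) v))
                    , subst (∣ W ∣ ≤_) (cong suc (∣△⁅⁆∣-∉ u∉Y)) (∣X△⁅u⁆∣≤1+∣X∣ (Y △ ⁅ u ⁆) v)
    where
    W = (Y △ ⁅ u ⁆) △ ⁅ v ⁆

  rmax-attained-∋ : Feasible F X → u ∈ X → ∃ λ W → Feasible F W × u ∈ W × ∣ W ∣ ≡ rmax F
  rmax-attained-∋ X∈F u∈X with rmax-attained F X∈F
  ... | Y , Y∈F , ∣Y∣≡ with feasible-∋-near X∈F u∈X Y∈F
  ...   | W , W∈F , u∈W , ∣Y∣≤∣W∣ , _ =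
    W , W∈F , u∈W , ≤-antisym (∣X∣≤rmax F W∈F) (subst (_≤ ∣ W ∣) ∣Y∣≡ ∣Y∣≤∣W∣)

  ∋-≤2+rmin : Feasible F X → u ∈ X → ∃ λ W → Feasible F W × u ∈ W × ∣ W ∣ ≤ 2 + rmin F
  ∋-≤2+rmin X∈F u∈X with rmin-attained F X∈F
  ... | Y , Y∈F , ∣Y∣≡ with feasible-∋-near X∈F u∈X Y∈F
  ...   | W , W∈F , u∈W , _ , ∣W∣≤2+∣Y∣ =
    W , W∈F , u∈W , subst (λ k → ∣ W ∣ ≤ 2 + k) ∣Y∣≡ ∣W∣≤2+∣Y∣

-- Ribbon loops and orientability

record MinSize∋ (F : Family n) (e : Fin n) (m : ℕ) : Set where
  field
    lowerBound : Feasible F X → e ∈ X → m ≤ ∣ X ∣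
    attained   : ∃ λ X → Feasible F X × e ∈ X × ∣ X ∣ ≡ m

≤-≤2+⇒≡⊎≡1+⊎≡2+ : ∀ {a m} → a ≤ m → m ≤ 2 + a → m ≡ a ⊎ m ≡ suc a ⊎ m ≡ 2 + a
≤-≤2+⇒≡⊎≡1+⊎≡2+ {zero}  {zero}              _         _               = inj₁ refl
≤-≤2+⇒≡⊎≡1+⊎≡2+ {zero}  {suc zero}          _         _               = inj₂ (inj₁ refl)
≤-≤2+⇒≡⊎≡1+⊎≡2+ {zero}  {suc (suc zero)}    _         _               = inj₂ (inj₂ refl)
≤-≤2+⇒≡⊎≡1+⊎≡2+ {zero}  {suc (suc (suc _))} _         (s≤s (s≤s ()))
≤-≤2+⇒≡⊎≡1+⊎≡2+ {suc a} {suc m}             (s≤s a≤m) (s≤s m≤2+a)     =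
  Sum.map (cong suc) (Sum.map (cong suc) (cong suc)) (≤-≤2+⇒≡⊎≡1+⊎≡2+ a≤m m≤2+a)

module _ {F : Family n} {e : Fin n} where

  open MinSize∋

  minSize∋-cases : IsDeltaMatroid F → ∀ {m} → MinSize∋ F e m →
                   m ≡ rmin F ⊎ m ≡ suc (rmin F) ⊎ m ≡ 2 + rmin F
  minSize∋-cases D min∋ with attained min∋
  ... | X , X∈F , e∈X , ∣X∣≡m with ∋-≤2+rmin D X∈F e∈X
  ...   | W , W∈F , e∈W , ∣W∣≤2+rmin =
    ≤-≤2+⇒≡⊎≡1+⊎≡2+ (subst (rmin F ≤_) ∣X∣≡m (rmin≤∣X∣ F X∈F))
                    (≤-trans (lowerBound min∋ W∈F e∈W) ∣W∣≤2+rmin)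

  ¬ribbonLoop : MinSize∋ F e (rmin F) → ¬ RibbonLoop F e
  ¬ribbonLoop min∋ ribbon with attained min∋
  ... | X , X∈F , e∈X , ∣X∣≡ = ribbon X X∈F ∣X∣≡ e∈X

  ribbonLoop : (∀ {X} → Feasible F X → e ∈ X → suc (rmin F) ≤ ∣ X ∣) → RibbonLoop F e
  ribbonLoop bound X X∈F ∣X∣≡ e∈X = <-irrefl (sym ∣X∣≡) (bound X∈F e∈X)

  -- A minimum feasible set Y avoids e, and Y △ {e} is a minimum set of D * {e} containing e.
  orientable : Feasible F X → (∀ {X} → Feasible F X → e ∈ X → 2 + rmin F ≤ ∣ X ∣) →
               OrientableAt F e
  orientable X∈F bound with rmin-attained F X∈F
  ... | Y , Y∈F , ∣Y∣≡ =
    Y △ ⁅ e ⁆ , twist-feasible⁺ F e Y∈F , trans ∣Y△e∣≡ (sym rmin-twist) , ∈-△⁅⁆ e∉Y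
    where
    e∉Y : e ∉ Y
    e∉Y e∈Y = 1+n≰n (≤-trans (n≤1+n _) (subst (2 + rmin F ≤_) ∣Y∣≡ (bound Y∈F e∈Y)))
    ∣Y△e∣≡ : ∣ Y △ ⁅ e ⁆ ∣ ≡ suc (rmin F)
    ∣Y△e∣≡ = trans (∣△⁅⁆∣-∉ e∉Y) (cong suc ∣Y∣≡)
    rmin-twist : rmin (twist F ⁅ e ⁆) ≡ suc (rmin F)
    rmin-twist = rmin≡bound (twist F ⁅ e ⁆)
      (twist-lowerBound F e _ (λ X∈F _ → s≤s (rmin≤∣X∣ F X∈F)) bound)
      (twist-feasible⁺ F e Y∈F) ∣Y△e∣≡

  -- Now r_min(D * {e}) = r_min(D), and a set of that size containing e would come
  -- from a feasible set of D that is smaller still.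
  ¬orientable : MinSize∋ F e (suc (rmin F)) → ¬ OrientableAt F e
  ¬orientable min∋ (Z , Z∈F* , ∣Z∣≡ , e∈Z) with attained min∋
  ... | X , X∈F , e∈X , ∣X∣≡ =
    1+n≰n (subst (_≤ ∣ Z △ ⁅ e ⁆ ∣) rmin≡1+∣Z△e∣ (rmin≤∣X∣ F (twist-feasible⁻ F e Z∈F*)))
    where
    ∣X△e∣≡ : ∣ X △ ⁅ e ⁆ ∣ ≡ rmin F
    ∣X△e∣≡ = suc-injective (trans (∣△⁅⁆∣-∈ e∈X) ∣X∣≡)
    rmin-twist : rmin (twist F ⁅ e ⁆) ≡ rmin F
    rmin-twist = rmin≡bound (twist F ⁅ e ⁆)
      (twist-lowerBound F e _ (λ X∈F _ → ≤-trans (rmin≤∣X∣ F X∈F) (n≤1+n _)) (lowerBound min∋))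
      (twist-feasible⁺ F e X∈F) ∣X△e∣≡
    rmin≡1+∣Z△e∣ : rmin F ≡ suc ∣ Z △ ⁅ e ⁆ ∣
    rmin≡1+∣Z△e∣ = trans (sym rmin-twist) (trans (sym ∣Z∣≡) (sym (∣△⁅⁆∣-∈ e∈Z)))

-- The contraction formula

ContractionLaw : Family (suc n) → Fin (suc n) → Set
ContractionLaw F e =
    ((¬ RibbonLoop F e) → twoRho F ≡ twoRho (contract F e) + 2)
  × ((RibbonLoop F e × OrientableAt F e) → twoRho F ≡ twoRho (contract F e))
  × ((RibbonLoop F e × ¬ OrientableAt F e) → twoRho F ≡ twoRho (contract F e) + 1)

module _ {F : Family (suc n)} {e : Fin (suc n)} where

  law-¬ribbonLoop : ¬ RibbonLoop F e → twoRho F ≡ twoRho (contract F e) + 2 → ContractionLaw F e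
  law-¬ribbonLoop ¬ribbon eq = (λ _ → eq) , (λ (ribbon , _) → contradiction ribbon ¬ribbon)
                                          , (λ (ribbon , _) → contradiction ribbon ¬ribbon)

  law-orientable : RibbonLoop F e → OrientableAt F e → twoRho F ≡ twoRho (contract F e) →
                   ContractionLaw F e
  law-orientable ribbon or eq = (λ ¬ribbon → contradiction ribbon ¬ribbon) , (λ _ → eq)
                              , (λ (_ , ¬or) → contradiction or ¬or)

  law-¬orientable : RibbonLoop F e → ¬ OrientableAt F e → twoRho F ≡ twoRho (contract F e) + 1 →
                    ContractionLaw F e
  law-¬orientable ribbon ¬or eq = (λ ¬ribbon → contradiction ribbon ¬ribbon)
                                , (λ (_ , or) → contradiction or ¬or) , (λ _ → eq)

module _ {F : Family (suc n)} (D : IsDeltaMatroid F) (e : Fin (suc n)) where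

  private
    X₀∈F : Feasible F (proj₁ (IsDeltaMatroid.nonempty D))
    X₀∈F = proj₂ (IsDeltaMatroid.nonempty D)

  module Loop (loop : isLoopᵇ F e ≡ true) where

    removeAt-feasible : Feasible F X → Feasible (contract F e) (removeAt X e)
    removeAt-feasible X∈F =
      contract-feasible⁺ F e loop X∈F (∉⇒lookup≡false (isLoop⇒∉ F e loop X∈F))

    ∣removeAt∣ : Feasible F X → ∣ removeAt X e ∣ ≡ ∣ X ∣
    ∣removeAt∣ X∈F = ∣removeAt∣-∉ (isLoop⇒∉ F e loop X∈F)

    rmax-contract : rmax (contract F e) ≡ rmax F
    rmax-contract with rmax-attained F X₀∈F
    ... | X , X∈F , ∣X∣≡ = rmax≡bound (contract F e)
      (λ {Y} Y∈F/e → subst (_≤ rmax F) (∣insertAt-false∣ Y e) (∣X∣≤rmax F (contract-feasible⁻ F e loop Y∈F/e)))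
      (removeAt-feasible X∈F) (trans (∣removeAt∣ X∈F) ∣X∣≡)

    rmin-contract : rmin (contract F e) ≡ rmin F
    rmin-contract with rmin-attained F X₀∈F
    ... | X , X∈F , ∣X∣≡ = rmin≡bound (contract F e)
      (λ {Y} Y∈F/e → subst (rmin F ≤_) (∣insertAt-false∣ Y e) (rmin≤∣X∣ F (contract-feasible⁻ F e loop Y∈F/e)))
      (removeAt-feasible X∈F) (trans (∣removeAt∣ X∈F) ∣X∣≡)

    law : ContractionLaw F e
    law = law-orientable (λ X X∈F _ → isLoop⇒∉ F e loop X∈F)
                         (orientable X₀∈F λ X∈F e∈X → contradiction e∈X (isLoop⇒∉ F e loop X∈F))
                         (sym (cong₂ _+_ rmax-contract rmin-contract))

  module NonLoop (nonloop : isLoopᵇ F e ≡ false) where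

    M b : ℕ
    M = rmax (contract F e)
    b = rmin (contract F e)

    removeAt-feasible : Feasible F X → e ∈ X → Feasible (contract F e) (removeAt X e)
    removeAt-feasible X∈F e∈X = contract-feasible⁺ F e nonloop X∈F ([]=⇒lookup e∈X)

    suc-rmax-contract : suc M ≡ rmax F
    suc-rmax-contract with ¬isLoop⇒∈ F e nonloop
    ... | X , X∈F , e∈X with rmax-attained-∋ D X∈F e∈X
    ...   | W , W∈F , e∈W , ∣W∣≡ =
      trans (cong suc (rmax≡bound (contract F e) bound (removeAt-feasible W∈F e∈W) refl)) 1+∣W-e∣≡rmax
      where
      1+∣W-e∣≡rmax : suc ∣ removeAt W e ∣ ≡ rmax F
      1+∣W-e∣≡rmax = trans (∣removeAt∣-∈ e∈W) ∣W∣≡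
      bound : ∀ {Y} → Feasible (contract F e) Y → ∣ Y ∣ ≤ ∣ removeAt W e ∣
      bound {Y} Y∈F/e = s≤s⁻¹ (subst₂ _≤_ (∣insertAt-true∣ Y e) (sym 1+∣W-e∣≡rmax)
                                  (∣X∣≤rmax F (contract-feasible⁻ F e nonloop Y∈F/e)))

    minSize∋-contract : MinSize∋ F e (suc b)
    minSize∋-contract = record { lowerBound = lowerBound ; attained = attained }
      where
      lowerBound : Feasible F X → e ∈ X → suc b ≤ ∣ X ∣
      lowerBound X∈F e∈X =
        subst (suc b ≤_) (∣removeAt∣-∈ e∈X) (s≤s (rmin≤∣X∣ (contract F e) (removeAt-feasible X∈F e∈X)))
      attained : ∃ λ X → Feasible F X × e ∈ X × ∣ X ∣ ≡ suc b
      attained with ¬isLoop⇒∈ F e nonloop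
      ... | X , X∈F , e∈X with rmin-attained (contract F e) (removeAt-feasible X∈F e∈X)
      ...   | Y , Y∈F/e , ∣Y∣≡ = insertAt Y e true , contract-feasible⁻ F e nonloop Y∈F/e
                                , lookup⇒[]= e _ (insertAt-lookup Y e true)
                                , trans (∣insertAt-true∣ Y e) (cong suc ∣Y∣≡)

    open MinSize∋ minSize∋-contract using (lowerBound)
    open ≡-Reasoning

    1+b≡a⇒law : suc b ≡ rmin F → ContractionLaw F e
    1+b≡a⇒law 1+b≡a = law-¬ribbonLoop
      (¬ribbonLoop (subst (MinSize∋ F e) 1+b≡a minSize∋-contract))
      (begin
        rmax F + rmin F  ≡⟨ cong₂ _+_ (sym suc-rmax-contract) (sym 1+b≡a) ⟩
        suc M + suc b    ≡⟨ cong suc (+-suc M b) ⟩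
        2 + (M + b)      ≡⟨ +-comm 2 (M + b) ⟩
        M + b + 2        ∎)

    1+b≡1+a⇒law : suc b ≡ suc (rmin F) → ContractionLaw F e
    1+b≡1+a⇒law 1+b≡1+a = law-¬orientable
      (ribbonLoop λ {X} X∈F e∈X → subst (_≤ ∣ X ∣) 1+b≡1+a (lowerBound X∈F e∈X))
      (¬orientable (subst (MinSize∋ F e) 1+b≡1+a minSize∋-contract))
      (begin
        rmax F + rmin F  ≡⟨ cong₂ _+_ (sym suc-rmax-contract) (sym (suc-injective 1+b≡1+a)) ⟩
        1 + (M + b)      ≡⟨ +-comm 1 (M + b) ⟩
        M + b + 1        ∎)

    1+b≡2+a⇒law : suc b ≡ 2 + rmin F → ContractionLaw F e
    1+b≡2+a⇒law 1+b≡2+a = law-orientable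
      (ribbonLoop λ X∈F e∈X → ≤-trans (n≤1+n _) (2+a≤ X∈F e∈X))
      (orientable X₀∈F 2+a≤)
      (begin
        rmax F + rmin F  ≡⟨ cong (_+ rmin F) (sym suc-rmax-contract) ⟩
        suc M + rmin F   ≡⟨ +-suc M (rmin F) ⟨
        M + suc (rmin F) ≡⟨ cong (M +_) (suc-injective 1+b≡2+a) ⟨
        M + b            ∎)
      where
      2+a≤ : ∀ {X} → Feasible F X → e ∈ X → 2 + rmin F ≤ ∣ X ∣
      2+a≤ {X} X∈F e∈X = subst (_≤ ∣ X ∣) 1+b≡2+a (lowerBound X∈F e∈X)

    law : ContractionLaw F e
    law = [ 1+b≡a⇒law , [ 1+b≡1+a⇒law , 1+b≡2+a⇒law ]′ ]′ (minSize∋-cases D minSize∋-contract)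

lemma3p27 : (n : ℕ) (F : Family (suc n)) → IsDeltaMatroid F → (e : Fin (suc n)) →
    ((¬ RibbonLoop F e) → twoRho F ≡ twoRho (contract F e) + 2)
    × ((RibbonLoop F e × OrientableAt F e) → twoRho F ≡ twoRho (contract F e))
    × ((RibbonLoop F e × ¬ OrientableAt F e) → twoRho F ≡ twoRho (contract F e) + 1)
lemma3p27 n F D e = law (isLoopᵇ F e) refl
  where
  law : ∀ l → isLoopᵇ F e ≡ l → ContractionLaw F e
  law true  loop    = Loop.law D e loop
  law false nonloop = NonLoop.law D e nonloop
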